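{- Let $w\in W_e$ and let $x_1x_2\cdots x_n$ be the permutation of $[n]$ obtained from the window $w_1w_2\cdots w_n$ by replacing its entries by $1,\dots,n$ so that relative order is preserved. Write $w=u\cdot z$ with $u\in W_f$, $z$ of minimal length in its coset $W_fz$, and $\ell(w)=\ell(u)+\ell(z)$. Then $u$ is the element of $W_f$ with window $x_1x_2\cdots x_n$.
   Context: Fix $n\ge2$. $W_e$: bijections $w:\mathbb Z\to\mathbb Z$ with $w(i+n)=w(i)+n$ (and $\sum_{i=1}^n(w(i)-i)\equiv0\bmod n$); $s_i$ swaps $i+kn,i+1+kn$; $\pi:k\mapsto k+1$; $W_a=\langle s_0,\dots,s_{n-1}\rangle$ (Coxeter of type $\tilde A_{n-1}$), $W_e=\langle\pi\rangle\ltimes W_a$, $\ell(\pi^kv)=\ell(v)$; $W_f=\langle s_1,\dots,s_{n-1}\rangle\cong\mathcal S_n$. The word of $w$ is $w_i=n+1-w^{ -1}(i)$, identified with its window $w_1\cdots w_n$ (entries with distinct residues mod $n$); the identity has window $n\,(n-1)\cdots1$; for $1\le i\le n-1$, $s_iw$ has the window of $w$ with entries $i,i+1$ swapped; elements of $W_f$ are those whose window is a permutation of $[n]$. -}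

module Defs where

open import Data.Nat as ℕ using (ℕ; zero; suc; NonZero; _≡ᵇ_)
import Data.Nat.DivMod as ℕD
open import Data.Integer as ℤ using (ℤ; +_; _-_)
open import Data.Integer.DivMod using (_%ℕ_)
open import Data.Integer.Divisibility using (_∣_)
open import Data.Fin using (Fin; toℕ)
open import Data.Bool using (if_then_else_)
open import Data.List using (List; []; _∷_; foldr; applyUpTo; length; filter)
open import Data.List.Relation.Unary.All using (All)
open import Data.List.Base using (filter)
open import Data.Product using (Σ; _×_)
open import Data.Fin using (Fin)
open import Data.List using (allFin)
open import Relation.Binary.PropositionalEquality using (_≡_; _≢_)
open import Function using (id; _∘_)

sumℤ : List ℤ → ℤ
sumℤ = foldr ℤ._+_ (+ 0)

-- Equality of elements is pointwise.
record We (n : ℕ) : Set where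
  field
    fun      : ℤ → ℤ
    inv      : ℤ → ℤ
    inv-fun  : ∀ i → inv (fun i) ≡ i
    fun-inv  : ∀ i → fun (inv i) ≡ i
    periodic : ∀ i → fun (i ℤ.+ + n) ≡ fun i ℤ.+ + n
    sumCond  : + n ∣ sumℤ (applyUpTo (λ k → fun (+ suc k) - + suc k) n)
open We public

-- The simple reflection s_i (i = 0,…,n-1) as a map ℤ → ℤ:
-- swaps i + kn and i+1 + kn for all k.
s : (n : ℕ) .{{_ : NonZero n}} → Fin n → ℤ → ℤ
s n i k =
  if (k %ℕ n) ≡ᵇ toℕ i then k ℤ.+ + 1
  else if (k %ℕ n) ≡ᵇ ((suc (toℕ i)) ℕD.% n) then k - + 1
  else k

evalWord : (n : ℕ) .{{_ : NonZero n}} → List (Fin n) → ℤ → ℤ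
evalWord n = foldr (λ i f → s n i ∘ f) id

-- ℓ(w) = k : w = π^m v with v ∈ W_a of Coxeter length k (π^m : x ↦ x + m),
-- i.e. k is the minimal length of a word in s_0,…,s_{n-1} with w = π^m · word.
HasLength : (n : ℕ) .{{_ : NonZero n}} → We n → ℕ → Set
HasLength n w k =
  Σ ℤ (λ m → Σ (List (Fin n)) (λ ws →
     length ws ≡ k × (∀ x → fun w x ≡ evalWord n ws x ℤ.+ m)))
  × (∀ (m : ℤ) (ws : List (Fin n)) →
       (∀ x → fun w x ≡ evalWord n ws x ℤ.+ m) → k ℕ.≤ length ws)

InWf : (n : ℕ) .{{_ : NonZero n}} → We n → Set
InWf n v = Σ (List (Fin n)) (λ ws →
  All (λ i → toℕ i ≢ 0) ws × (∀ x → fun v x ≡ evalWord n ws x))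

window : (n : ℕ) → We n → Fin n → ℤ
window n w j = + suc n - inv w (+ suc (toℕ j))

-- standardization: replace entries by 1,…,n preserving relative order;
-- the entry at position j becomes #{k : a_k ≤ a_j}.
standardize : (n : ℕ) → (Fin n → ℤ) → Fin n → ℕ
standardize n a j = length (filter (λ k → a k ℤ.≤? a j) (allFin n))

MinInCoset : (n : ℕ) .{{_ : NonZero n}} → We n → ℕ → Set
MinInCoset n z ℓz = ∀ (v y : We n) (k : ℕ) → InWf n v →
  (∀ x → fun y x ≡ fun v (fun z x)) → HasLength n y k → ℓz ℕ.≤ k

-- Write the window of w as n+1 − w⁻¹(i) with w⁻¹ = z⁻¹ u⁻¹. Since u ∈ W_f permutes {1,…,n}, it suffices
-- that z⁻¹ is increasing on 1,…,n: then the entries n+1 − z⁻¹(u⁻¹(i)) are in the same relative order as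
-- the entries n+1 − u⁻¹(i) of u's window, which is already a permutation of [n]. If z⁻¹(k) > z⁻¹(k+1)
-- for some 1 ≤ k < n, then s_k z ∈ W_f z would be shorter than z. Lengths are computed by Shi's formula
-- ℓ(w) = Σ_{1≤i<j≤n} |⌊(w(j) − w(i))/n⌋|: left multiplication by s_k changes only the term of the pair
-- of positions whose values are ≡ k, k+1 (mod n), by at most one, and by exactly −1 at a left descent;
-- an element without left descents is a translation, so peeling off descents yields a word of length ℓ(w).

module Submission where

open import Data.Bool using (true; false)
open import Data.Bool.Properties using (T-≡; ¬-not)
open import Data.Empty using (⊥-elim)
open import Data.Fin as F using (Fin; toℕ)
import Data.Fin.Properties as FP
open import Data.Integer as ℤ using (ℤ; +_; -[1+_]; _-_; _+_; _*_; -_; ∣_∣; _⊖_)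
open import Data.Integer.DivMod using (_%ℕ_; _/ℕ_; a≡a%ℕn+[a/ℕn]*n; n%ℕd<d)
open import Data.Integer.Divisibility using (_∣_)
import Data.Integer.Properties as ℤP
open import Data.Integer.Tactic.RingSolver using (solve-∀)
open import Data.List using (List; []; _∷_; length; filter; allFin; applyUpTo)
open import Data.List.Membership.Propositional using (_∈_)
open import Data.List.Membership.Propositional.Properties using (∈-allFin)
open import Data.List.Properties
  using (filter-accept; filter-reject; filter-none; filter-all; filter-≐; length-tabulate)
open import Data.List.Relation.Unary.All as All using (All; []; _∷_)
open import Data.List.Relation.Unary.Any using (here; there)
open import Data.List.Relation.Unary.Unique.Propositional using (Unique; []; _∷_)
open import Data.List.Relation.Unary.Unique.Propositional.Properties using (allFin⁺)
open import Data.Nat as ℕ using (ℕ; zero; suc; z≤n; s≤s; _∸_; NonZero)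
import Data.Nat.DivMod as ℕD
import Data.Nat.Divisibility as ℕDv
import Data.Nat.Properties as ℕP
open import Algebra.Properties.CommutativeSemigroup ℕP.+-commutativeSemigroup using (xy∙z≈xz∙y)
open import Data.Product using (Σ; _,_; _×_; proj₁; proj₂)
open import Data.Sum using (_⊎_; inj₁; inj₂; [_,_]; map₂)
open import Function using (_∘_; id; flip)
open import Function.Bundles using (_⇔_; mk⇔; Equivalence)
open import Function.Definitions using (Injective)
open import Relation.Binary.Definitions using (tri<; tri≈; tri>)
open import Relation.Binary.PropositionalEquality hiding ([_])
open import Relation.Nullary using (¬_; Dec; yes; no)
open import Relation.Unary using (Pred; Decidable)

open import Defs

module _ {A : Set} {ℓ} {P : Pred A ℓ} (P? : Decidable P) where

  length-filter-⊎ : ∀ {Q R : Pred A ℓ} (Q? : Decidable Q) (R? : Decidable R) →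
    (∀ {x} → P x → Q x ⊎ R x) → (∀ {x} → Q x → P x) → (∀ {x} → R x → P x) →
    (∀ {x} → Q x → ¬ R x) →
    ∀ xs → length (filter P? xs) ≡ length (filter Q? xs) ℕ.+ length (filter R? xs)
  length-filter-⊎ Q? R? P⇒Q⊎R Q⇒P R⇒P Q⇒¬R [] = refl
  length-filter-⊎ Q? R? P⇒Q⊎R Q⇒P R⇒P Q⇒¬R (x ∷ xs) with Q? x | R? x
  ... | yes q | yes r = ⊥-elim (Q⇒¬R q r)
  ... | yes q | no _ rewrite filter-accept P? {x} {xs} (Q⇒P q) =
    cong suc (length-filter-⊎ Q? R? P⇒Q⊎R Q⇒P R⇒P Q⇒¬R xs)
  ... | no _ | yes r rewrite filter-accept P? {x} {xs} (R⇒P r) =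
    trans (cong suc (length-filter-⊎ Q? R? P⇒Q⊎R Q⇒P R⇒P Q⇒¬R xs)) (sym (ℕP.+-suc _ _))
  ... | no ¬q | no ¬r rewrite filter-reject P? {x} {xs} ([ ¬q , ¬r ] ∘ P⇒Q⊎R) =
    length-filter-⊎ Q? R? P⇒Q⊎R Q⇒P R⇒P Q⇒¬R xs

  length-filter-unique : ∀ {x xs} → Unique xs → x ∈ xs → P x → (∀ {y} → P y → y ≡ x) →
    length (filter P? xs) ≡ 1
  length-filter-unique {x} {_ ∷ xs} (x∉xs ∷ _) (here refl) Px only
    rewrite filter-accept P? {x} {xs} Px =
    cong (suc ∘ length) (filter-none P? (All.map (λ x≢y Py → x≢y (sym (only Py))) x∉xs))
  length-filter-unique {x} {y ∷ ys} (y∉ys ∷ uniq) (there x∈ys) Px only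
    rewrite filter-reject P? {y} {ys} (λ Py → All.lookup y∉ys x∈ys (only Py)) =
    length-filter-unique uniq x∈ys Px only

module _ {n} (π : Fin n → ℕ) (π<n : ∀ k → π k ℕ.< n) (π-injective : Injective _≡_ _≡_ π)
         (π-onto : ∀ {c} → c ℕ.< n → Σ (Fin n) λ k → π k ≡ c) where

  count-≡ : ∀ {c} → c ℕ.< n → length (filter (λ k → π k ℕ.≟ c) (allFin n)) ≡ 1
  count-≡ {c} c<n with π-onto c<n
  ... | k , πk≡c = length-filter-unique (λ k → π k ℕ.≟ c) (allFin⁺ n) (∈-allFin k) πk≡c
                     (λ πj≡c → π-injective (trans πj≡c (sym πk≡c)))

  count-≥ : ∀ c → c ℕ.≤ n → length (filter (λ k → c ℕ.≤? π k) (allFin n)) ≡ n ∸ c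
  count-≥ zero _ =
    trans (cong length (filter-all _ (All.universal (λ _ → z≤n) (allFin n)))) (length-tabulate id)
  count-≥ (suc c) c<n = ℕP.+-cancelʳ-≡ 1 _ _ (begin
    #≥ (suc c) ℕ.+ 1                                            ≡⟨ cong (#≥ (suc c) ℕ.+_) (count-≡ c<n) ⟨
    #≥ (suc c) ℕ.+ length (filter (λ k → π k ℕ.≟ c) (allFin n))  ≡⟨ split ⟨
    #≥ c                                                        ≡⟨ count-≥ c (ℕP.<⇒≤ c<n) ⟩
    n ∸ c                                                       ≡⟨ ℕP.+-∸-assoc 1 c<n ⟩
    suc (n ∸ suc c)                                             ≡⟨ ℕP.+-comm 1 _ ⟩
    n ∸ suc c ℕ.+ 1                                             ∎)
    where
    open ≡-Reasoning
    #≥ : ℕ → ℕ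
    #≥ c = length (filter (λ k → c ℕ.≤? π k) (allFin n))
    split : #≥ c ≡ #≥ (suc c) ℕ.+ length (filter (λ k → π k ℕ.≟ c) (allFin n))
    split = length-filter-⊎ (λ k → c ℕ.≤? π k) _ _ (map₂ sym ∘ ℕP.m≤n⇒m<n∨m≡n) ℕP.<⇒≤
              (ℕP.≤-reflexive ∘ sym) (λ c<πk πk≡c → ℕP.<-irrefl (sym πk≡c) c<πk) (allFin n)

  standardize-antitone : ∀ (W : Fin n → ℤ) → (∀ {a b} → π a ℕ.< π b → W b ℤ.< W a) →
    ∀ j → standardize n W j ≡ n ∸ π j
  standardize-antitone W anti j =
    trans (cong length (filter-≐ (λ k → W k ℤ.≤? W j) (λ k → π j ℕ.≤? π k) (≤⇒≥ , ≥⇒≤) (allFin n)))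
      (count-≥ (π j) (ℕP.<⇒≤ (π<n j)))
    where
    ≤⇒≥ : ∀ {k} → W k ℤ.≤ W j → π j ℕ.≤ π k
    ≤⇒≥ Wk≤Wj = ℕP.≮⇒≥ (λ πk<πj → ℤP.<⇒≱ (anti πk<πj) Wk≤Wj)
    ≥⇒≤ : ∀ {k} → π j ℕ.≤ π k → W k ℤ.≤ W j
    ≥⇒≤ πj≤πk with ℕP.m≤n⇒m<n∨m≡n πj≤πk
    ... | inj₁ πj<πk = ℤP.<⇒≤ (anti πj<πk)
    ... | inj₂ πj≡πk = ℤP.≤-reflexive (cong W (π-injective (sym πj≡πk)))

∑< : ℕ → (ℕ → ℕ) → ℕ
∑< zero    g = 0
∑< (suc m) g = ∑< m g ℕ.+ g m

syntax ∑< m (λ a → e) = ∑[ a < m ] e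

∑<-cong : ∀ m {g h : ℕ → ℕ} → (∀ {a} → a ℕ.< m → g a ≡ h a) → ∑< m g ≡ ∑< m h
∑<-cong zero    g≡h = refl
∑<-cong (suc m) g≡h = cong₂ ℕ._+_ (∑<-cong m (g≡h ∘ ℕP.m<n⇒m<1+n)) (g≡h ℕP.≤-refl)

∑<-zero : ∀ m {g : ℕ → ℕ} → (∀ {a} → a ℕ.< m → g a ≡ 0) → ∑< m g ≡ 0
∑<-zero zero    g≡0 = refl
∑<-zero (suc m) g≡0 = cong₂ ℕ._+_ (∑<-zero m (g≡0 ∘ ℕP.m<n⇒m<1+n)) (g≡0 ℕP.≤-refl)

∑<-update : ∀ m {g h : ℕ → ℕ} {c e e′} → c ℕ.< m → (∀ {a} → a ℕ.< m → a ≢ c → g a ≡ h a) →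
  g c ℕ.+ e ≡ h c ℕ.+ e′ → ∑< m g ℕ.+ e ≡ ∑< m h ℕ.+ e′
∑<-update (suc m) {g} {h} {c} {e} {e′} c<1+m g≡h gc≡hc with m ℕP.≟ c
... | yes refl = begin
  ∑< m g ℕ.+ g m ℕ.+ e    ≡⟨ ℕP.+-assoc (∑< m g) _ _ ⟩
  ∑< m g ℕ.+ (g m ℕ.+ e)  ≡⟨ cong₂ ℕ._+_ (∑<-cong m (λ a<m → g≡h (ℕP.m<n⇒m<1+n a<m) (ℕP.<⇒≢ a<m)))
                                          gc≡hc ⟩
  ∑< m h ℕ.+ (h m ℕ.+ e′) ≡⟨ ℕP.+-assoc (∑< m h) _ _ ⟨
  ∑< m h ℕ.+ h m ℕ.+ e′   ∎
  where open ≡-Reasoning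
... | no m≢c = begin
  ∑< m g ℕ.+ g m ℕ.+ e    ≡⟨ xy∙z≈xz∙y (∑< m g) _ _ ⟩
  ∑< m g ℕ.+ e ℕ.+ g m    ≡⟨ cong₂ ℕ._+_ (∑<-update m c<m (g≡h ∘ ℕP.m<n⇒m<1+n) gc≡hc)
                                          (g≡h ℕP.≤-refl m≢c) ⟩
  ∑< m h ℕ.+ e′ ℕ.+ h m   ≡⟨ xy∙z≈xz∙y (∑< m h) _ _ ⟩
  ∑< m h ℕ.+ h m ℕ.+ e′   ∎
  where open ≡-Reasoning
        c<m : c ℕ.< m
        c<m = ℕP.≤∧≢⇒< (ℕP.≤-pred c<1+m) (m≢c ∘ sym)

pairSum : ℕ → (ℕ → ℕ → ℕ) → ℕ
pairSum m G = ∑[ b < m ] ∑[ a < b ] G a b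

pairSum-cong : ∀ m {G H : ℕ → ℕ → ℕ} → (∀ {a b} → a ℕ.< b → b ℕ.< m → G a b ≡ H a b) →
  pairSum m G ≡ pairSum m H
pairSum-cong m G≡H = ∑<-cong m (λ b<m → ∑<-cong _ (λ a<b → G≡H a<b b<m))

pairSum-zero : ∀ m {G : ℕ → ℕ → ℕ} → (∀ {a b} → a ℕ.< b → b ℕ.< m → G a b ≡ 0) →
  pairSum m G ≡ 0
pairSum-zero m G≡0 = ∑<-zero m (λ b<m → ∑<-zero _ (λ a<b → G≡0 a<b b<m))

pairSum-update : ∀ m {G H : ℕ → ℕ → ℕ} {p q e e′} → p ℕ.< q → q ℕ.< m →
  (∀ {a b} → a ℕ.< b → b ℕ.< m → ¬ (a ≡ p × b ≡ q) → G a b ≡ H a b) →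
  G p q ℕ.+ e ≡ H p q ℕ.+ e′ → pairSum m G ℕ.+ e ≡ pairSum m H ℕ.+ e′
pairSum-update m p<q q<m G≡H Gpq≡Hpq = ∑<-update m q<m
  (λ b<m b≢q → ∑<-cong _ (λ a<b → G≡H a<b b<m (b≢q ∘ proj₂)))
  (∑<-update _ p<q (λ a<q a≢p → G≡H a<q q<m (a≢p ∘ proj₁)) Gpq≡Hpq)

pairSum-update-≤ : ∀ m {G H : ℕ → ℕ → ℕ} {p q d} → p ℕ.< q → q ℕ.< m →
  (∀ {a b} → a ℕ.< b → b ℕ.< m → ¬ (a ≡ p × b ≡ q) → G a b ≡ H a b) →
  G p q ℕ.≤ H p q ℕ.+ d → pairSum m G ℕ.≤ pairSum m H ℕ.+ d
pairSum-update-≤ m p<q q<m G≡H Gpq≤ = ℕP.m+n≤o⇒m≤o (pairSum m _)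
  (ℕP.≤-reflexive (pairSum-update m p<q q<m G≡H (ℕP.m+[n∸m]≡n Gpq≤)))

sumℤ-cong : ∀ m {F G : ℕ → ℤ} → (∀ {j} → j ℕ.< m → F j ≡ G j) →
  sumℤ (applyUpTo F m) ≡ sumℤ (applyUpTo G m)
sumℤ-cong zero    F≡G = refl
sumℤ-cong (suc m) F≡G = cong₂ _+_ (F≡G ℕP.0<1+n) (sumℤ-cong m (F≡G ∘ s≤s))

sumℤ-update : ∀ m {F G : ℕ → ℤ} {c} → c ℕ.< m → (∀ {j} → j ℕ.< m → j ≢ c → F j ≡ G j) →
  sumℤ (applyUpTo F m) ≡ sumℤ (applyUpTo G m) + (F c - G c)
sumℤ-update (suc m) {F} {G} {zero} _ F≡G =
  trans (cong (_+_ (F 0)) (sumℤ-cong m (λ j<m → F≡G (s≤s j<m) λ ()))) (alg (F 0) (G 0) _)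
  where alg : ∀ a b s → a + s ≡ b + s + (a - b)
        alg = solve-∀
sumℤ-update (suc m) {F} {G} {suc c} (s≤s c<m) F≡G =
  trans (cong₂ _+_ (F≡G ℕP.0<1+n λ ())
                   (sumℤ-update m c<m (λ j<m → F≡G (s≤s j<m) ∘ (_∘ ℕP.suc-injective))))
        (sym (ℤP.+-assoc (G 0) _ _))

sumℤ-update₂ : ∀ m {F G : ℕ → ℤ} {a b} → a ≢ b → a ℕ.< m → b ℕ.< m →
  (∀ {j} → j ℕ.< m → j ≢ a → j ≢ b → F j ≡ G j) →
  sumℤ (applyUpTo F m) ≡ sumℤ (applyUpTo G m) + (F a - G a) + (F b - G b)
sumℤ-update₂ (suc m) {a = zero} {zero} a≢b _ _ _ = ⊥-elim (a≢b refl)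
sumℤ-update₂ (suc m) {F} {G} {zero} {suc b} _ _ (s≤s b<m) F≡G =
  trans (cong (_+_ (F 0)) (sumℤ-update m b<m (λ j<m j≢b → F≡G (s≤s j<m) (λ ()) (j≢b ∘ ℕP.suc-injective))))
        (alg (F 0) (G 0) _ (F (suc b) - G (suc b)))
  where alg : ∀ a b s d → a + (s + d) ≡ b + s + (a - b) + d
        alg = solve-∀
sumℤ-update₂ (suc m) {F} {G} {suc a} {zero} _ (s≤s a<m) _ F≡G =
  trans (cong (_+_ (F 0)) (sumℤ-update m a<m (λ j<m j≢a → F≡G (s≤s j<m) (j≢a ∘ ℕP.suc-injective) (λ ()))))
        (alg (F 0) (G 0) _ (F (suc a) - G (suc a)))
  where alg : ∀ a b s d → a + (s + d) ≡ b + s + d + (a - b)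
        alg = solve-∀
sumℤ-update₂ (suc m) {F} {G} {suc a} {suc b} a≢b (s≤s a<m) (s≤s b<m) F≡G =
  trans (cong₂ _+_ (F≡G ℕP.0<1+n (λ ()) (λ ()))
          (sumℤ-update₂ m (a≢b ∘ cong suc) a<m b<m
            (λ j<m j≢a j≢b → F≡G (s≤s j<m) (j≢a ∘ ℕP.suc-injective) (j≢b ∘ ℕP.suc-injective))))
        (alg (G 0) _ (F (suc a) - G (suc a)) (F (suc b) - G (suc b)))
  where alg : ∀ g s d e → g + (s + d + e) ≡ g + s + d + e
        alg = solve-∀

sumℤ-zero : ∀ m → sumℤ (applyUpTo (λ _ → + 0) m) ≡ + 0
sumℤ-zero zero    = refl
sumℤ-zero (suc m) = trans (ℤP.+-identityˡ _) (sumℤ-zero m)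

∣-[1+j]+1∣+1≡1+j : ∀ j → ∣ -[1+ j ] + + 1 ∣ ℕ.+ 1 ≡ suc j
∣-[1+j]+1∣+1≡1+j zero    = refl
∣-[1+j]+1∣+1≡1+j (suc j) = ℕP.+-comm (suc j) 1

i≤j⇒∃[k]i+k≡j : ∀ {i j} → i ℤ.≤ j → Σ ℕ λ k → i + + k ≡ j
i≤j⇒∃[k]i+k≡j {i} {j} i≤j with j - i in j-i≡ | ℤP.i≤j⇒0≤j-i i≤j
... | + k | _ = k , (begin
  i + + k       ≡⟨ cong (λ d → i + d) j-i≡ ⟨
  i + (j - i)   ≡⟨ alg i j ⟩
  j             ∎)
  where open ≡-Reasoning
        alg : ∀ i j → i + (j - i) ≡ j
        alg = solve-∀

i<j⇒∃[k]i+1+k≡j : ∀ {i j} → i ℤ.< j → Σ ℕ λ k → i + + suc k ≡ j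
i<j⇒∃[k]i+1+k≡j {i} i<j with i≤j⇒∃[k]i+k≡j (ℤP.i<j⇒suc[i]≤j i<j)
... | k , 1+i+k≡j = k , trans (alg i (+ k)) 1+i+k≡j
  where alg : ∀ i k → i + (+ 1 + k) ≡ + 1 + i + k
        alg = solve-∀

+-cancelʳ-≤ : ∀ c {x y} → x + c ℤ.≤ y + c → x ℤ.≤ y
+-cancelʳ-≤ c {x} {y} le = subst₂ ℤ._≤_ (alg x c) (alg y c) (ℤP.+-monoˡ-≤ (- c) le)
  where alg : ∀ x c → x + c + - c ≡ x
        alg = solve-∀

+-cancelʳ-< : ∀ c {x y} → x + c ℤ.< y + c → x ℤ.< y
+-cancelʳ-< c {x} {y} lt = subst₂ ℤ._<_ (alg x c) (alg y c) (ℤP.+-monoˡ-< (- c) lt)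
  where alg : ∀ x c → x + c + - c ≡ x
        alg = solve-∀

≡⇒≡ᵇ-true : ∀ {m n} → m ≡ n → (m ℕ.≡ᵇ n) ≡ true
≡⇒≡ᵇ-true {m} {n} m≡n = Equivalence.to T-≡ (ℕP.≡⇒≡ᵇ m n m≡n)

≢⇒≡ᵇ-false : ∀ {m n} → m ≢ n → (m ℕ.≡ᵇ n) ≡ false
≢⇒≡ᵇ-false {m} {n} m≢n = ¬-not (m≢n ∘ ℕP.≡ᵇ⇒≡ m n ∘ Equivalence.from T-≡)

module AffinePermutations (n : ℕ) .{{_ : NonZero n}} (1<n : 1 ℕ.< n) where

  -- The ring solver treats the module parameter N as opaque, so algebraic identities below
  -- quantify over N explicitly.

  N : ℤ
  N = + n

  rem : ℤ → ℕ
  rem t = t %ℕ n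

  quo : ℤ → ℤ
  quo t = t /ℕ n

  rem+quo : ∀ t → t ≡ + rem t + quo t * N
  rem+quo t = a≡a%ℕn+[a/ℕn]*n t n

  rem<n : ∀ t → rem t ℕ.< n
  rem<n t = n%ℕd<d t n

  private
    n≤rem : ∀ {r r′ q q′} → q ℤ.< q′ → + r + q * N ≡ + r′ + q′ * N → n ℕ.≤ r
    n≤rem {r} {r′} {q} q<q′ eq with i<j⇒∃[k]i+1+k≡j q<q′
    ... | k , refl = begin
      n                    ≤⟨ ℕP.m≤n*m n (suc k) ⟩
      suc k ℕ.* n          ≤⟨ ℕP.m≤n+m _ r′ ⟩
      r′ ℕ.+ suc k ℕ.* n   ≡⟨ ℤP.+-injective r≡ ⟨
      r                    ∎
      where
      open ℕP.≤-Reasoning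
      alg₁ : ∀ r q N → r ≡ r + q * N - q * N
      alg₁ = solve-∀
      alg₂ : ∀ r′ q k N → r′ + (q + k) * N - q * N ≡ r′ + k * N
      alg₂ = solve-∀
      r≡ : + r ≡ + (r′ ℕ.+ suc k ℕ.* n)
      r≡ = trans (alg₁ (+ r) q N) (trans (cong (_- q * N) eq)
             (trans (alg₂ (+ r′) q (+ suc k) N) (cong (λ m → + r′ + m) (sym (ℤP.pos-* (suc k) n)))))

  divMod-unique : ∀ {t r q} → r ℕ.< n → t ≡ + r + q * N → rem t ≡ r × quo t ≡ q
  divMod-unique {t} {r} {q} r<n t≡ = rem≡r , quo≡q
    where
    eq : + rem t + quo t * N ≡ + r + q * N
    eq = trans (sym (rem+quo t)) t≡
    quo≡q : quo t ≡ q
    quo≡q with ℤP.<-cmp (quo t) q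
    ... | tri< lt _ _ = ⊥-elim (ℕP.<⇒≱ (rem<n t) (n≤rem lt eq))
    ... | tri≈ _ e _  = e
    ... | tri> _ _ gt = ⊥-elim (ℕP.<⇒≱ r<n (n≤rem gt (sym eq)))
    alg : ∀ r q N → r ≡ r + q * N - q * N
    alg = solve-∀
    rem≡r : rem t ≡ r
    rem≡r = ℤP.+-injective (trans (alg (+ rem t) (quo t) N)
              (trans (cong₂ (λ a b → a - b * N) eq quo≡q) (sym (alg (+ r) q N))))

  rem-+-multiple : ∀ x c → rem (x + c * N) ≡ rem x
  rem-+-multiple x c = proj₁ (divMod-unique {x + c * N} {rem x} {quo x + c} (rem<n x)
    (trans (cong (_+ c * N) (rem+quo x)) (alg (+ rem x) (quo x) c N)))
    where alg : ∀ r q c N → r + q * N + c * N ≡ r + (q + c) * N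
          alg = solve-∀

  rem-small : ∀ {m} → m ℕ.< n → rem (+ m) ≡ m
  rem-small = ℕD.m<n⇒m%n≡m

  rem≡⇒≡+multiple : ∀ x y → rem x ≡ rem y → x ≡ y + (quo x - quo y) * N
  rem≡⇒≡+multiple x y eq = begin
    x                                      ≡⟨ rem+quo x ⟩
    + rem x + quo x * N                    ≡⟨ cong (λ r → + r + quo x * N) eq ⟩
    + rem y + quo x * N                    ≡⟨ alg (+ rem y) (quo x) (quo y) N ⟩
    + rem y + quo y * N + (quo x - quo y) * N ≡⟨ cong (_+ (quo x - quo y) * N) (rem+quo y) ⟨
    y + (quo x - quo y) * N                ∎
    where open ≡-Reasoning
          alg : ∀ r a b N → r + a * N ≡ r + b * N + (a - b) * N
          alg = solve-∀

  rem-+ : ∀ x y a → rem x ≡ rem y → rem (x + a) ≡ rem (y + a)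
  rem-+ x y a eq = begin
    rem (x + a)                           ≡⟨ cong (λ t → rem (t + a)) (rem≡⇒≡+multiple x y eq) ⟩
    rem (y + (quo x - quo y) * N + a)     ≡⟨ cong rem (alg y (quo x - quo y) a N) ⟩
    rem (y + a + (quo x - quo y) * N)     ≡⟨ rem-+-multiple (y + a) (quo x - quo y) ⟩
    rem (y + a)                           ∎
    where open ≡-Reasoning
          alg : ∀ y c a N → y + c * N + a ≡ y + a + c * N
          alg = solve-∀

  divMod-<-of-quo-< : ∀ {r r′ q q′} → r′ ℕ.< n → q′ ℤ.< q → + r′ + q′ * N ℤ.< + r + q * N
  divMod-<-of-quo-< {r} {r′} {q} {q′} r′<n q′<q = begin-strict
    + r′ + q′ * N       <⟨ ℤP.+-monoˡ-< (q′ * N) (ℤ.+<+ r′<n) ⟩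
    N + q′ * N          ≡⟨ alg q′ N ⟩
    (+ 1 + q′) * N      ≤⟨ ℤP.*-monoʳ-≤-nonNeg N (ℤP.i<j⇒suc[i]≤j q′<q) ⟩
    q * N               ≤⟨ ℤP.i≤j+i (q * N) (+ r) ⟩
    + r + q * N         ∎
    where open ℤP.≤-Reasoning
          alg : ∀ q N → N + q * N ≡ (+ 1 + q) * N
          alg = solve-∀

  divMod-<⇒quo-≤ : ∀ {r r′ q q′} → r ℕ.< n → + r′ + q′ * N ℤ.< + r + q * N → q′ ℤ.≤ q
  divMod-<⇒quo-≤ r<n lt = ℤP.≮⇒≥ (λ q<q′ → ℤP.<-asym lt (divMod-<-of-quo-< r<n q<q′))

  divMod-<⇒quo-< : ∀ {r r′ q q′} → r ℕ.< n → r ℕ.≤ r′ →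
    + r′ + q′ * N ℤ.< + r + q * N → q′ ℤ.< q
  divMod-<⇒quo-< {r} {r′} {q} {q′} r<n r≤r′ lt with ℤP.<-cmp q′ q
  ... | tri< q′<q _ _ = q′<q
  ... | tri≈ _ refl _ = ⊥-elim (ℕP.<⇒≱ (ℤP.drop‿+<+ (+-cancelʳ-< (q * N) lt)) r≤r′)
  ... | tri> _ _ q<q′ = ⊥-elim (ℤP.<-asym lt (divMod-<-of-quo-< r<n q<q′))

  succMod : Fin n → ℕ
  succMod k = rem (+ suc (toℕ k))

  succMod≢ : ∀ k → succMod k ≢ toℕ k
  succMod≢ k eq with suc (toℕ k) ℕ.<? n
  ... | yes k+1<n = ℕP.1+n≢n (trans (sym (rem-small k+1<n)) eq)
  ... | no  k+1≮n = ℕP.<-irrefl (trans (cong suc (sym k≡0)) k+1≡n) 1<n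
    where
    k+1≡n : suc (toℕ k) ≡ n
    k+1≡n = ℕP.≤-antisym (FP.toℕ<n k) (ℕP.≮⇒≥ k+1≮n)
    k≡0 : toℕ k ≡ 0
    k≡0 = trans (sym eq) (trans (cong (ℕ._% n) k+1≡n) (ℕD.n%n≡0 n))

  s-up : ∀ k t → rem t ≡ toℕ k → s n k t ≡ t + + 1
  s-up k t eq rewrite ≡⇒≡ᵇ-true eq = refl

  s-down : ∀ k t → rem t ≡ succMod k → s n k t ≡ t - + 1
  s-down k t eq rewrite ≢⇒≡ᵇ-false (succMod≢ k ∘ trans (sym eq)) | ≡⇒≡ᵇ-true eq = refl

  s-fix : ∀ k t → rem t ≢ toℕ k → rem t ≢ succMod k → s n k t ≡ t
  s-fix k t ≢k ≢k+1 rewrite ≢⇒≡ᵇ-false ≢k | ≢⇒≡ᵇ-false ≢k+1 = refl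

  rem-toℕ : ∀ (k : Fin n) → rem (+ toℕ k) ≡ toℕ k
  rem-toℕ k = rem-small (FP.toℕ<n k)

  rem-suc : ∀ k t → rem t ≡ toℕ k → rem (t + + 1) ≡ succMod k
  rem-suc k t eq = trans (rem-+ t (+ toℕ k) (+ 1) (trans eq (sym (rem-toℕ k))))
                         (cong (λ m → rem (+ m)) (ℕP.+-comm (toℕ k) 1))

  rem-pred : ∀ k t → rem t ≡ succMod k → rem (t - + 1) ≡ toℕ k
  rem-pred k t eq = trans (rem-+ t (+ suc (toℕ k)) (- + 1) eq) (rem-toℕ k)

  s-involutive : ∀ k t → s n k (s n k t) ≡ t
  s-involutive k t with rem t ℕ.≟ toℕ k | rem t ℕ.≟ succMod k
  ... | yes ≡k | _ = begin
    s n k (s n k t)       ≡⟨ cong (s n k) (s-up k t ≡k) ⟩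
    s n k (t + + 1)       ≡⟨ s-down k (t + + 1) (rem-suc k t ≡k) ⟩
    t + + 1 - + 1         ≡⟨ alg t ⟩
    t                     ∎
    where open ≡-Reasoning
          alg : ∀ t → t + + 1 - + 1 ≡ t
          alg = solve-∀
  ... | no _ | yes ≡k+1 = begin
    s n k (s n k t)       ≡⟨ cong (s n k) (s-down k t ≡k+1) ⟩
    s n k (t - + 1)       ≡⟨ s-up k (t - + 1) (rem-pred k t ≡k+1) ⟩
    t - + 1 + + 1         ≡⟨ alg t ⟩
    t                     ∎
    where open ≡-Reasoning
          alg : ∀ t → t - + 1 + + 1 ≡ t
          alg = solve-∀
  ... | no ≢k | no ≢k+1 = trans (cong (s n k) (s-fix k t ≢k ≢k+1)) (s-fix k t ≢k ≢k+1)

  s-+-multiple : ∀ k t c → s n k (t + c * N) ≡ s n k t + c * N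
  s-+-multiple k t c with rem t ℕ.≟ toℕ k | rem t ℕ.≟ succMod k | rem-+-multiple t c
  ... | yes ≡k | _ | same = begin
    s n k (t + c * N)   ≡⟨ s-up k (t + c * N) (trans same ≡k) ⟩
    t + c * N + + 1     ≡⟨ alg t c N (+ 1) ⟩
    t + + 1 + c * N     ≡⟨ cong (_+ c * N) (s-up k t ≡k) ⟨
    s n k t + c * N     ∎
    where open ≡-Reasoning
          alg : ∀ t c N d → t + c * N + d ≡ t + d + c * N
          alg = solve-∀
  ... | no _ | yes ≡k+1 | same = begin
    s n k (t + c * N)   ≡⟨ s-down k (t + c * N) (trans same ≡k+1) ⟩
    t + c * N - + 1     ≡⟨ alg t c N (- + 1) ⟩
    t - + 1 + c * N     ≡⟨ cong (_+ c * N) (s-down k t ≡k+1) ⟨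
    s n k t + c * N     ∎
    where open ≡-Reasoning
          alg : ∀ t c N d → t + c * N + d ≡ t + d + c * N
          alg = solve-∀
  ... | no ≢k | no ≢k+1 | same =
    trans (s-fix k (t + c * N) (≢k ∘ trans (sym same)) (≢k+1 ∘ trans (sym same)))
          (cong (_+ c * N) (sym (s-fix k t ≢k ≢k+1)))

  s-periodic : ∀ k t → s n k (t + N) ≡ s n k t + N
  s-periodic k t = begin
    s n k (t + N)          ≡⟨ cong (s n k) (alg t N) ⟩
    s n k (t + + 1 * N)    ≡⟨ s-+-multiple k t (+ 1) ⟩
    s n k t + + 1 * N      ≡⟨ alg (s n k t) N ⟨
    s n k t + N            ∎
    where open ≡-Reasoning
          alg : ∀ t N → t + N ≡ t + + 1 * N
          alg = solve-∀

  rem-+⇔ : ∀ t m u → (rem (t + m) ≡ rem u) ⇔ (rem t ≡ rem (u - m))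
  rem-+⇔ t m u = mk⇔
    (λ eq → trans (cong rem (alg₁ t m)) (rem-+ (t + m) u (- m) eq))
    (λ eq → trans (rem-+ t (u - m) m eq) (cong rem (alg₂ u m)))
    where alg₁ : ∀ t m → t ≡ t + m - m
          alg₁ = solve-∀
          alg₂ : ∀ u m → u - m + m ≡ u
          alg₂ = solve-∀

  shiftIndex : Fin n → ℤ → Fin n
  shiftIndex k m = F.fromℕ< (rem<n (+ toℕ k - m))

  toℕ-shiftIndex : ∀ k m → toℕ (shiftIndex k m) ≡ rem (+ toℕ k - m)
  toℕ-shiftIndex k m = FP.toℕ-fromℕ< (rem<n (+ toℕ k - m))

  succMod-shiftIndex : ∀ k m → succMod (shiftIndex k m) ≡ rem (+ suc (toℕ k) - m)
  succMod-shiftIndex k m = begin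
    rem (+ 1 + + toℕ k′)       ≡⟨ cong rem (ℤP.+-comm (+ 1) (+ toℕ k′)) ⟩
    rem (+ toℕ k′ + + 1)       ≡⟨ rem-+ (+ toℕ k′) (+ toℕ k - m) (+ 1)
                                         (trans (rem-toℕ k′) (toℕ-shiftIndex k m)) ⟩
    rem (+ toℕ k - m + + 1)    ≡⟨ cong rem (alg (+ toℕ k) m) ⟩
    rem (+ 1 + + toℕ k - m)    ∎
    where open ≡-Reasoning
          k′ : Fin n
          k′ = shiftIndex k m
          alg : ∀ a m → a - m + + 1 ≡ + 1 + a - m
          alg = solve-∀

  rem-+≡toℕ⇔ : ∀ k m t → (rem (t + m) ≡ toℕ k) ⇔ (rem t ≡ toℕ (shiftIndex k m))
  rem-+≡toℕ⇔ k m t = mk⇔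
    (λ eq → trans (to (trans eq (sym (rem-toℕ k)))) (sym (toℕ-shiftIndex k m)))
    (λ eq → trans (from (trans eq (toℕ-shiftIndex k m))) (rem-toℕ k))
    where open Equivalence (rem-+⇔ t m (+ toℕ k))

  rem-+≡succMod⇔ : ∀ k m t → (rem (t + m) ≡ succMod k) ⇔ (rem t ≡ succMod (shiftIndex k m))
  rem-+≡succMod⇔ k m t = mk⇔
    (λ eq → trans (to eq) (sym (succMod-shiftIndex k m)))
    (λ eq → from (trans eq (succMod-shiftIndex k m)))
    where open Equivalence (rem-+⇔ t m (+ suc (toℕ k)))

  s-shift : ∀ k m t → s n k (t + m) ≡ s n (shiftIndex k m) t + m
  s-shift k m t with rem (t + m) ℕ.≟ toℕ k | rem (t + m) ℕ.≟ succMod k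
  ... | yes ≡k | _ = begin
    s n k (t + m)     ≡⟨ s-up k (t + m) ≡k ⟩
    t + m + + 1       ≡⟨ alg t m (+ 1) ⟩
    t + + 1 + m       ≡⟨ cong (_+ m) (s-up k′ t (Equivalence.to (rem-+≡toℕ⇔ k m t) ≡k)) ⟨
    s n k′ t + m      ∎
    where open ≡-Reasoning
          k′ : Fin n
          k′ = shiftIndex k m
          alg : ∀ t m d → t + m + d ≡ t + d + m
          alg = solve-∀
  ... | no _ | yes ≡k+1 = begin
    s n k (t + m)     ≡⟨ s-down k (t + m) ≡k+1 ⟩
    t + m - + 1       ≡⟨ alg t m (- + 1) ⟩
    t - + 1 + m       ≡⟨ cong (_+ m) (s-down k′ t (Equivalence.to (rem-+≡succMod⇔ k m t) ≡k+1)) ⟨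
    s n k′ t + m      ∎
    where open ≡-Reasoning
          k′ : Fin n
          k′ = shiftIndex k m
          alg : ∀ t m d → t + m + d ≡ t + d + m
          alg = solve-∀
  ... | no ≢k | no ≢k+1 = trans (s-fix k (t + m) ≢k ≢k+1) (cong (_+ m) (sym (s-fix (shiftIndex k m) t
          (≢k ∘ Equivalence.from (rem-+≡toℕ⇔ k m t)) (≢k+1 ∘ Equivalence.from (rem-+≡succMod⇔ k m t)))))

  -- How s_k changes ⌊(y − x)/n⌋

  n′ : ℕ
  n′ = ℕ.pred n

  n′<n : n′ ℕ.< n
  n′<n = ℕP.≤-reflexive (ℕP.suc-pred n)

  N≡1+n′ : N ≡ + 1 + + n′
  N≡1+n′ = cong +_ (sym (ℕP.suc-pred n))

  rem-n′+ : ∀ x → rem (+ n′ + x) ≡ rem (x - + 1)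
  rem-n′+ x = begin
    rem (+ n′ + x)                           ≡⟨ cong rem (alg (+ n′) x) ⟩
    rem (x - + 1 + + 1 * (+ 1 + + n′))       ≡⟨ cong (λ M → rem (x - + 1 + + 1 * M)) N≡1+n′ ⟨
    rem (x - + 1 + + 1 * N)                  ≡⟨ rem-+-multiple (x - + 1) (+ 1) ⟩
    rem (x - + 1)                            ∎
    where open ≡-Reasoning
          alg : ∀ m x → m + x ≡ x - + 1 + + 1 * (+ 1 + m)
          alg = solve-∀

  rem-diff⇔ : ∀ x y u → (rem (y - x) ≡ rem u) ⇔ (rem y ≡ rem (u + x))
  rem-diff⇔ x y u = mk⇔ (λ eq → trans (to eq) (cong rem (alg u x)))
                        (λ eq → from (trans eq (cong rem (sym (alg u x)))))
    where open Equivalence (rem-+⇔ y (- x) u)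
          alg : ∀ u x → u - - x ≡ u + x
          alg = solve-∀

  rem-diff≢0 : ∀ x y → rem x ≢ rem y → rem (y - x) ≢ 0
  rem-diff≢0 x y ≢ eq = ≢ (sym (trans (Equivalence.to (rem-diff⇔ x y (+ 0)) (trans eq (sym (rem-small 0<n))))
    (cong rem (ℤP.+-identityˡ x))))
    where 0<n : 0 ℕ.< n
          0<n = ℕP.<-trans ℕP.0<1+n 1<n

  rem-diff≡n′ : ∀ x y → rem (y - x) ≡ n′ → rem y ≡ rem (x - + 1)
  rem-diff≡n′ x y eq =
    trans (Equivalence.to (rem-diff⇔ x y (+ n′)) (trans eq (sym (rem-small n′<n)))) (rem-n′+ x)

  rem-diff-up : ∀ k x y → rem x ≡ toℕ k → rem y ≡ succMod k → rem (y - x) ≡ 1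
  rem-diff-up k x y ≡k ≡k+1 = trans (Equivalence.from (rem-diff⇔ x y (+ 1)) (begin
    rem y               ≡⟨ ≡k+1 ⟩
    rem (+ 1 + + toℕ k) ≡⟨ cong rem (ℤP.+-comm (+ 1) (+ toℕ k)) ⟩
    rem (+ toℕ k + + 1) ≡⟨ rem-+ (+ toℕ k) x (+ 1) (trans (rem-toℕ k) (sym ≡k)) ⟩
    rem (x + + 1)       ≡⟨ cong rem (ℤP.+-comm x (+ 1)) ⟩
    rem (+ 1 + x)       ∎)) (rem-small 1<n)
    where open ≡-Reasoning

  rem-diff-down : ∀ k x y → rem x ≡ succMod k → rem y ≡ toℕ k → rem (y - x) ≡ n′
  rem-diff-down k x y ≡k+1 ≡k = trans (Equivalence.from (rem-diff⇔ x y (+ n′))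
    (trans ≡k (sym (trans (rem-n′+ x) (rem-pred k x ≡k+1))))) (rem-small n′<n)

  quo-+-within : ∀ d e {r} → + rem d + e ≡ + r → r ℕ.< n → quo (d + e) ≡ quo d
  quo-+-within d e {r} eq r<n = proj₂ (divMod-unique r<n (begin
    d + e                     ≡⟨ cong (_+ e) (rem+quo d) ⟩
    + rem d + quo d * N + e   ≡⟨ alg (+ rem d) (quo d * N) e ⟩
    + rem d + e + quo d * N   ≡⟨ cong (_+ quo d * N) eq ⟩
    + r + quo d * N           ∎))
    where open ≡-Reasoning
          alg : ∀ a b c → a + b + c ≡ a + c + b
          alg = solve-∀

  quo-pred : ∀ d → rem d ≢ 0 → quo (d - + 1) ≡ quo d
  quo-pred d ≢0 with rem d in eq
  ... | zero  = ⊥-elim (≢0 refl)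
  ... | suc r = quo-+-within d (- + 1) (cong (λ m → + m - + 1) eq)
                  (ℕP.<-trans (ℕP.n<1+n r) (subst (ℕ._< n) eq (rem<n d)))

  quo-suc : ∀ d → rem d ≢ n′ → quo (d + + 1) ≡ quo d
  quo-suc d ≢n′ = quo-+-within d (+ 1) (cong +_ (ℕP.+-comm (rem d) 1))
    (ℕP.≤∧≢⇒< (rem<n d) (≢n′ ∘ ℕP.suc-injective ∘ flip trans (sym (ℕP.suc-pred n))))

  quo-minus2 : ∀ d → rem d ≡ 1 → quo (d - + 2) ≡ quo d - + 1
  quo-minus2 d ≡1 = proj₂ (divMod-unique n′<n (begin
    d - + 2                               ≡⟨ cong (_- + 2) (rem+quo d) ⟩
    + rem d + quo d * N - + 2             ≡⟨ cong₂ (λ r M → + r + quo d * M - + 2) ≡1 N≡1+n′ ⟩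
    + 1 + quo d * (+ 1 + + n′) - + 2      ≡⟨ alg (quo d) (+ n′) ⟩
    + n′ + (quo d - + 1) * (+ 1 + + n′)   ≡⟨ cong (λ M → + n′ + (quo d - + 1) * M) N≡1+n′ ⟨
    + n′ + (quo d - + 1) * N              ∎))
    where open ≡-Reasoning
          alg : ∀ q m → + 1 + q * (+ 1 + m) - + 2 ≡ m + (q - + 1) * (+ 1 + m)
          alg = solve-∀

  quo-plus2 : ∀ d → rem d ≡ n′ → quo (d + + 2) ≡ quo d + + 1
  quo-plus2 d ≡n′ = proj₂ (divMod-unique 1<n (begin
    d + + 2                               ≡⟨ cong (_+ + 2) (rem+quo d) ⟩
    + rem d + quo d * N + + 2             ≡⟨ cong₂ (λ r M → + r + quo d * M + + 2) ≡n′ N≡1+n′ ⟩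
    + n′ + quo d * (+ 1 + + n′) + + 2     ≡⟨ alg (quo d) (+ n′) ⟩
    + 1 + (quo d + + 1) * (+ 1 + + n′)    ≡⟨ cong (λ M → + 1 + (quo d + + 1) * M) N≡1+n′ ⟨
    + 1 + (quo d + + 1) * N               ∎))
    where open ≡-Reasoning
          alg : ∀ q m → m + q * (+ 1 + m) + + 2 ≡ + 1 + (q + + 1) * (+ 1 + m)
          alg = solve-∀

  diffQuo : ℤ → ℤ → ℤ
  diffQuo x y = quo (y - x)

  diffQuo-s-up : ∀ k x y → rem x ≡ toℕ k → rem y ≡ succMod k →
    diffQuo (s n k x) (s n k y) ≡ diffQuo x y - + 1
  diffQuo-s-up k x y ≡k ≡k+1 rewrite s-up k x ≡k | s-down k y ≡k+1 =
    trans (cong quo (alg x y)) (quo-minus2 (y - x) (rem-diff-up k x y ≡k ≡k+1))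
    where alg : ∀ x y → y - + 1 - (x + + 1) ≡ y - x - + 2
          alg = solve-∀

  diffQuo-s-down : ∀ k x y → rem x ≡ succMod k → rem y ≡ toℕ k →
    diffQuo (s n k x) (s n k y) ≡ diffQuo x y + + 1
  diffQuo-s-down k x y ≡k+1 ≡k rewrite s-down k x ≡k+1 | s-up k y ≡k =
    trans (cong quo (alg x y)) (quo-plus2 (y - x) (rem-diff-down k x y ≡k+1 ≡k))
    where alg : ∀ x y → y + + 1 - (x - + 1) ≡ y - x + + 2
          alg = solve-∀

  diffQuo-s-other : ∀ k x y → rem x ≢ rem y →
    ¬ (rem x ≡ toℕ k × rem y ≡ succMod k) → ¬ (rem x ≡ succMod k × rem y ≡ toℕ k) →
    diffQuo (s n k x) (s n k y) ≡ diffQuo x y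
  diffQuo-s-other k x y x≢y ¬up ¬down
    with rem x ℕ.≟ toℕ k | rem x ℕ.≟ succMod k | rem y ℕ.≟ toℕ k | rem y ℕ.≟ succMod k
  ... | yes x≡k | _ | yes y≡k | _ = ⊥-elim (x≢y (trans x≡k (sym y≡k)))
  ... | yes x≡k | _ | no _ | yes y≡k+1 = ⊥-elim (¬up (x≡k , y≡k+1))
  ... | yes x≡k | _ | no y≢k | no y≢k+1 rewrite s-up k x x≡k | s-fix k y y≢k y≢k+1 =
    trans (cong quo (alg x y)) (quo-pred (y - x) (rem-diff≢0 x y x≢y))
    where alg : ∀ x y → y - (x + + 1) ≡ y - x - + 1
          alg = solve-∀
  ... | no _ | yes x≡k+1 | yes y≡k | _ = ⊥-elim (¬down (x≡k+1 , y≡k))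
  ... | no _ | yes x≡k+1 | no _ | yes y≡k+1 = ⊥-elim (x≢y (trans x≡k+1 (sym y≡k+1)))
  ... | no _ | yes x≡k+1 | no y≢k | no y≢k+1 rewrite s-down k x x≡k+1 | s-fix k y y≢k y≢k+1 =
    trans (cong quo (alg x y))
          (quo-suc (y - x) (λ eq → y≢k (trans (rem-diff≡n′ x y eq) (rem-pred k x x≡k+1))))
    where alg : ∀ x y → y - (x - + 1) ≡ y - x + + 1
          alg = solve-∀
  ... | no x≢k | no x≢k+1 | yes y≡k | _ rewrite s-fix k x x≢k x≢k+1 | s-up k y y≡k =
    trans (cong quo (alg x y)) (quo-suc (y - x) (λ eq → x≢k+1 (begin
      rem x               ≡⟨ cong rem (alg′ x) ⟩
      rem (x - + 1 + + 1) ≡⟨ rem-suc k (x - + 1) (trans (sym (rem-diff≡n′ x y eq)) y≡k) ⟩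
      succMod k           ∎)))
    where open ≡-Reasoning
          alg : ∀ x y → y + + 1 - x ≡ y - x + + 1
          alg = solve-∀
          alg′ : ∀ x → x ≡ x - + 1 + + 1
          alg′ = solve-∀
  ... | no x≢k | no x≢k+1 | no _ | yes y≡k+1 rewrite s-fix k x x≢k x≢k+1 | s-down k y y≡k+1 =
    trans (cong quo (alg x y)) (quo-pred (y - x) (rem-diff≢0 x y x≢y))
    where alg : ∀ x y → y - + 1 - x ≡ y - x - + 1
          alg = solve-∀
  ... | no x≢k | no x≢k+1 | no y≢k | no y≢k+1
    rewrite s-fix k x x≢k x≢k+1 | s-fix k y y≢k y≢k+1 = refl

  -- Positions 1,…,n are indexed by a < n; index t is the index of the position congruent to t.
  pos : ℕ → ℤ
  pos a = + suc a

  displacement : (ℤ → ℤ) → ℤ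
  displacement f = sumℤ (applyUpTo (λ j → f (pos j) - pos j) n)

  index : ℤ → ℕ
  index t = rem (t - + 1)

  index<n : ∀ t → index t ℕ.< n
  index<n t = rem<n (t - + 1)

  pos-index : ∀ t → pos (index t) ≡ t - quo (t - + 1) * N
  pos-index t = begin
    + 1 + + rem (t - + 1)                                    ≡⟨ alg₁ (+ rem (t - + 1)) (quo (t - + 1)) N ⟩
    + 1 + (+ rem (t - + 1) + quo (t - + 1) * N) - quo (t - + 1) * N
      ≡⟨ cong (λ u → + 1 + u - quo (t - + 1) * N) (rem+quo (t - + 1)) ⟨
    + 1 + (t - + 1) - quo (t - + 1) * N                      ≡⟨ cong (_- quo (t - + 1) * N) (alg₂ t) ⟩
    t - quo (t - + 1) * N                                    ∎
    where open ≡-Reasoning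
          alg₁ : ∀ r q N → + 1 + r ≡ + 1 + (r + q * N) - q * N
          alg₁ = solve-∀
          alg₂ : ∀ t → + 1 + (t - + 1) ≡ t
          alg₂ = solve-∀

  index-pos : ∀ {a} → a ℕ.< n → index (pos a) ≡ a
  index-pos {a} a<n = trans (cong rem (alg (+ a))) (rem-small a<n)
    where alg : ∀ a → + 1 + a - + 1 ≡ a
          alg = solve-∀

  module _ (w : We n) where

    fun-injective : ∀ {x y} → fun w x ≡ fun w y → x ≡ y
    fun-injective {x} {y} eq = trans (sym (inv-fun w x)) (trans (cong (inv w) eq) (inv-fun w y))

    inv-injective : ∀ {x y} → inv w x ≡ inv w y → x ≡ y
    inv-injective {x} {y} eq = trans (sym (fun-inv w x)) (trans (cong (fun w) eq) (fun-inv w y))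

    fun-+-multiple : ∀ x c → fun w (x + c * N) ≡ fun w x + c * N
    fun-+-multiple x (+ m) = go m
      where
      go : ∀ m → fun w (x + + m * N) ≡ fun w x + + m * N
      go zero = trans (cong (fun w) (alg x N)) (sym (alg (fun w x) N))
        where alg : ∀ x N → x + + 0 * N ≡ x
              alg = solve-∀
      go (suc m) = begin
        fun w (x + + suc m * N)       ≡⟨ cong (fun w) (alg x (+ m) N) ⟩
        fun w (x + + m * N + N)       ≡⟨ periodic w _ ⟩
        fun w (x + + m * N) + N       ≡⟨ cong (_+ N) (go m) ⟩
        fun w x + + m * N + N         ≡⟨ alg (fun w x) (+ m) N ⟨
        fun w x + + suc m * N         ∎
        where open ≡-Reasoning
              alg : ∀ x m N → x + (+ 1 + m) * N ≡ x + m * N + N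
              alg = solve-∀
    fun-+-multiple x c@(-[1+ m ]) = begin
      fun w (x + c * N)                           ≡⟨ alg₁ (fun w (x + c * N)) c N ⟩
      fun w (x + c * N) + - c * N + c * N         ≡⟨ cong (_+ c * N) (fun-+-multiple (x + c * N) (- c)) ⟨
      fun w (x + c * N + - c * N) + c * N         ≡⟨ cong (λ y → fun w y + c * N) (alg₂ x c N) ⟩
      fun w x + c * N                             ∎
      where open ≡-Reasoning
            alg₁ : ∀ y c N → y ≡ y + - c * N + c * N
            alg₁ = solve-∀
            alg₂ : ∀ x c N → x + c * N + - c * N ≡ x
            alg₂ = solve-∀

    inv-+-multiple : ∀ y c → inv w (y + c * N) ≡ inv w y + c * N
    inv-+-multiple y c = fun-injective (begin
      fun w (inv w (y + c * N))   ≡⟨ fun-inv w _ ⟩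
      y + c * N                   ≡⟨ cong (_+ c * N) (fun-inv w y) ⟨
      fun w (inv w y) + c * N     ≡⟨ fun-+-multiple (inv w y) c ⟨
      fun w (inv w y + c * N)     ∎)
      where open ≡-Reasoning

    rem-fun-injective : ∀ x y → rem (fun w x) ≡ rem (fun w y) → rem x ≡ rem y
    rem-fun-injective x y eq = begin
      rem x             ≡⟨ cong rem (fun-injective fx≡) ⟩
      rem (y + c * N)   ≡⟨ rem-+-multiple y c ⟩
      rem y             ∎
      where open ≡-Reasoning
            c : ℤ
            c = quo (fun w x) - quo (fun w y)
            fx≡ : fun w x ≡ fun w (y + c * N)
            fx≡ = trans (rem≡⇒≡+multiple (fun w x) (fun w y) eq) (sym (fun-+-multiple y c))

    fun-pos-injective : ∀ {a b} → a ℕ.< n → b ℕ.< n → rem (fun w (pos a)) ≡ rem (fun w (pos b)) → a ≡ b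
    fun-pos-injective {a} {b} a<n b<n eq = begin
      a                   ≡⟨ index-pos a<n ⟨
      rem (pos a - + 1)   ≡⟨ rem-+ (pos a) (pos b) (- + 1) (rem-fun-injective (pos a) (pos b) eq) ⟩
      rem (pos b - + 1)   ≡⟨ index-pos b<n ⟩
      b                   ∎
      where open ≡-Reasoning

    positionOf : ℤ → ℕ
    positionOf t = index (inv w t)

    positionOf<n : ∀ t → positionOf t ℕ.< n
    positionOf<n t = index<n (inv w t)

    fun-pos-positionOf : ∀ t → fun w (pos (positionOf t)) ≡ t - quo (inv w t - + 1) * N
    fun-pos-positionOf t = begin
      fun w (pos (positionOf t))   ≡⟨ cong (fun w) (pos-index (inv w t)) ⟩
      fun w (inv w t - q * N)      ≡⟨ cong (fun w) (alg (inv w t) q N) ⟩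
      fun w (inv w t + (- q) * N)  ≡⟨ fun-+-multiple (inv w t) (- q) ⟩
      fun w (inv w t) + (- q) * N  ≡⟨ cong₂ _+_ (fun-inv w t) (alg′ q N) ⟩
      t - q * N                    ∎
      where open ≡-Reasoning
            q : ℤ
            q = quo (inv w t - + 1)
            alg : ∀ x q N → x - q * N ≡ x + (- q) * N
            alg = solve-∀
            alg′ : ∀ q N → (- q) * N ≡ - (q * N)
            alg′ = solve-∀

    rem-fun-pos-positionOf : ∀ t → rem (fun w (pos (positionOf t))) ≡ rem t
    rem-fun-pos-positionOf t = trans (cong rem (trans (fun-pos-positionOf t) (alg t q N))) (rem-+-multiple t (- q))
      where q : ℤ
            q = quo (inv w t - + 1)
            alg : ∀ t q N → t - q * N ≡ t + (- q) * N
            alg = solve-∀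

  -- A and B are the positions whose values are ≡ k and ≡ k+1 (mod n): the only ones s_k moves.
  module Swap (w : We n) (k : Fin n) where

    A B : ℕ
    A = positionOf w (+ toℕ k)
    B = positionOf w (+ suc (toℕ k))

    A<n : A ℕ.< n
    A<n = positionOf<n w (+ toℕ k)

    B<n : B ℕ.< n
    B<n = positionOf<n w (+ suc (toℕ k))

    rem-A : rem (fun w (pos A)) ≡ toℕ k
    rem-A = trans (rem-fun-pos-positionOf w (+ toℕ k)) (rem-toℕ k)

    rem-B : rem (fun w (pos B)) ≡ succMod k
    rem-B = rem-fun-pos-positionOf w (+ suc (toℕ k))

    A≢B : A ≢ B
    A≢B A≡B = succMod≢ k (trans (sym rem-B) (trans (cong (λ a → rem (fun w (pos a))) (sym A≡B)) rem-A))

    ≡A : ∀ {j} → j ℕ.< n → rem (fun w (pos j)) ≡ toℕ k → j ≡ A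
    ≡A j<n eq = fun-pos-injective w j<n A<n (trans eq (sym rem-A))

    ≡B : ∀ {j} → j ℕ.< n → rem (fun w (pos j)) ≡ succMod k → j ≡ B
    ≡B j<n eq = fun-pos-injective w j<n B<n (trans eq (sym rem-B))

    s-fun-pos-other : ∀ {j} → j ℕ.< n → j ≢ A → j ≢ B → s n k (fun w (pos j)) ≡ fun w (pos j)
    s-fun-pos-other j<n j≢A j≢B = s-fix k _ (j≢A ∘ ≡A j<n) (j≢B ∘ ≡B j<n)

    displacement-s : displacement (s n k ∘ fun w) ≡ displacement (fun w)
    displacement-s = begin
      displacement (s n k ∘ fun w)
        ≡⟨ sumℤ-update₂ n A≢B A<n B<n (λ j<n j≢A j≢B → cong (_- pos _) (s-fun-pos-other j<n j≢A j≢B))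
         ⟩
      displacement (fun w) + δ A + δ B
        ≡⟨ cong₂ (λ u v → displacement (fun w) + u + v)
                 (δ≡ (s-up k (fun w (pos A)) rem-A)) (δ≡ (s-down k (fun w (pos B)) rem-B)) ⟩
      displacement (fun w) + + 1 + - + 1
        ≡⟨ alg (displacement (fun w)) ⟩
      displacement (fun w) ∎
      where
      open ≡-Reasoning
      δ : ℕ → ℤ
      δ j = (s n k (fun w (pos j)) - pos j) - (fun w (pos j) - pos j)
      δ≡ : ∀ {j c} → s n k (fun w (pos j)) ≡ fun w (pos j) + c → δ j ≡ c
      δ≡ {j} {c} eq = trans (cong (λ t → t - pos j - (fun w (pos j) - pos j)) eq)
                            (alg′ (fun w (pos j)) (pos j) c)
        where alg′ : ∀ f p c → f + c - p - (f - p) ≡ c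
              alg′ = solve-∀
      alg : ∀ d → d + + 1 + - + 1 ≡ d
      alg = solve-∀

  s[_]·_ : Fin n → We n → We n
  s[ k ]· w = record
    { fun      = s n k ∘ fun w
    ; inv      = inv w ∘ s n k
    ; inv-fun  = λ x → trans (cong (inv w) (s-involutive k (fun w x))) (inv-fun w x)
    ; fun-inv  = λ x → trans (cong (s n k) (fun-inv w (s n k x))) (s-involutive k x)
    ; periodic = λ x → trans (cong (s n k) (periodic w x)) (s-periodic k (fun w x))
    ; sumCond  = subst (+ n ∣_) (sym (Swap.displacement-s w k)) (sumCond w)
    }

  displacement-id : displacement id ≡ + 0
  displacement-id = trans (sumℤ-cong n (λ {j} _ → ℤP.+-inverseʳ (pos j))) (sumℤ-zero n)

  idWe : We n
  idWe = record
    { fun      = id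
    ; inv      = id
    ; inv-fun  = λ _ → refl
    ; fun-inv  = λ _ → refl
    ; periodic = λ _ → refl
    ; sumCond  = subst (+ n ∣_) (sym displacement-id) (n ℕDv.∣0)
    }

  -- Shi's length formula ℓ(w) = Σ_{1≤i<j≤n} |⌊(w(j) − w(i))/n⌋|

  pairTerm : (ℤ → ℤ) → ℕ → ℕ → ℕ
  pairTerm f a b = ∣ diffQuo (f (pos a)) (f (pos b)) ∣

  shiLength : (ℤ → ℤ) → ℕ
  shiLength f = pairSum n (pairTerm f)

  shiLength-cong : ∀ {f g} → (∀ x → f x ≡ g x) → shiLength f ≡ shiLength g
  shiLength-cong f≗g =
    pairSum-cong n (λ {a} {b} _ _ → cong₂ (λ u v → ∣ diffQuo u v ∣) (f≗g (pos a)) (f≗g (pos b)))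

  shiLength-+ : ∀ f c → shiLength (λ x → f x + c) ≡ shiLength f
  shiLength-+ f c = pairSum-cong n (λ {a} {b} _ _ → cong (λ d → ∣ quo d ∣) (alg (f (pos a)) (f (pos b)) c))
    where alg : ∀ x y c → y + c - (x + c) ≡ y - x
          alg = solve-∀

  shiLength-id : shiLength id ≡ 0
  shiLength-id = pairSum-zero n λ {a} {b} a<b b<n → begin
    ∣ (suc b ⊖ suc a) /ℕ n ∣ ≡⟨ cong (λ d → ∣ d /ℕ n ∣) (ℤP.⊖-≥ (s≤s (ℕP.<⇒≤ a<b))) ⟩
    (b ∸ a) ℕ./ n            ≡⟨ ℕD.m<n⇒m/n≡0 (ℕP.≤-<-trans (ℕP.m∸n≤m b a) b<n) ⟩
    0                        ∎
    where open ≡-Reasoning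

  shiLength-translation : ∀ c → shiLength (λ x → x + c) ≡ 0
  shiLength-translation c = trans (shiLength-+ id c) shiLength-id

  LeftDescent : We n → Fin n → Set
  LeftDescent w k = inv w (+ suc (toℕ k)) ℤ.< inv w (+ toℕ k)

  leftDescent? : ∀ w k → Dec (LeftDescent w k)
  leftDescent? w k = inv w (+ suc (toℕ k)) ℤ.<? inv w (+ toℕ k)

  module SwapLength (w : We n) (k : Fin n) where
    open Swap w k

    private
      f f′ : ℤ → ℤ
      f = fun w
      f′ = fun (s[ k ]· w)
      dAB dBA : ℤ
      dAB = diffQuo (f (pos A)) (f (pos B))
      dBA = diffQuo (f (pos B)) (f (pos A))

    pairTerm-s-other : ∀ {a b} → a ℕ.< b → b ℕ.< n → ¬ (a ≡ A × b ≡ B) → ¬ (a ≡ B × b ≡ A) →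
      pairTerm f′ a b ≡ pairTerm f a b
    pairTerm-s-other {a} {b} a<b b<n ¬AB ¬BA = cong ∣_∣ (diffQuo-s-other k (f (pos a)) (f (pos b))
      (ℕP.<⇒≢ a<b ∘ fun-pos-injective w a<n b<n)
      (λ (≡k , ≡k+1) → ¬AB (≡A a<n ≡k , ≡B b<n ≡k+1))
      (λ (≡k+1 , ≡k) → ¬BA (≡B a<n ≡k+1 , ≡A b<n ≡k)))
      where a<n : a ℕ.< n
            a<n = ℕP.<-trans a<b b<n

    pairTerm-s-except : ∀ {p q} → p ℕ.< q → (p ≡ A × q ≡ B) ⊎ (p ≡ B × q ≡ A) →
      ∀ {a b} → a ℕ.< b → b ℕ.< n → ¬ (a ≡ p × b ≡ q) → pairTerm f′ a b ≡ pairTerm f a b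
    pairTerm-s-except p<q (inj₁ (refl , refl)) a<b b<n ¬pq =
      pairTerm-s-other a<b b<n ¬pq (λ (a≡B , b≡A) → ℕP.<-asym p<q (subst₂ ℕ._<_ a≡B b≡A a<b))
    pairTerm-s-except p<q (inj₂ (refl , refl)) a<b b<n ¬pq =
      pairTerm-s-other a<b b<n (λ (a≡A , b≡B) → ℕP.<-asym p<q (subst₂ ℕ._<_ a≡A b≡B a<b)) ¬pq

    pairTerm-s-AB : pairTerm f′ A B ≡ ∣ dAB - + 1 ∣
    pairTerm-s-AB = cong ∣_∣ (diffQuo-s-up k (f (pos A)) (f (pos B)) rem-A rem-B)

    pairTerm-s-BA : pairTerm f′ B A ≡ ∣ dBA + + 1 ∣
    pairTerm-s-BA = cong ∣_∣ (diffQuo-s-down k (f (pos B)) (f (pos A)) rem-B rem-A)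

    shiLength-s-≤ : shiLength f′ ℕ.≤ shiLength f ℕ.+ 1
    shiLength-s-≤ with ℕP.<-cmp A B
    ... | tri< A<B _ _ = pairSum-update-≤ n A<B B<n (pairTerm-s-except A<B (inj₁ (refl , refl)))
      (subst (ℕ._≤ ∣ dAB ∣ ℕ.+ 1) (sym pairTerm-s-AB) (ℤP.∣i+j∣≤∣i∣+∣j∣ dAB (- + 1)))
    ... | tri≈ _ A≡B _ = ⊥-elim (A≢B A≡B)
    ... | tri> _ _ B<A = pairSum-update-≤ n B<A A<n (pairTerm-s-except B<A (inj₂ (refl , refl)))
      (subst (ℕ._≤ ∣ dBA ∣ ℕ.+ 1) (sym pairTerm-s-BA) (ℤP.∣i+j∣≤∣i∣+∣j∣ dBA (+ 1)))

    private
      α β : ℤ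
      α = quo (inv w (+ toℕ k) - + 1)
      β = quo (inv w (+ suc (toℕ k)) - + 1)

    dAB≡ : dAB ≡ α - β
    dAB≡ = proj₂ (divMod-unique 1<n (begin
      f (pos B) - f (pos A)                        ≡⟨ cong₂ _-_ (fun-pos-positionOf w _) (fun-pos-positionOf w _) ⟩
      (+ 1 + + toℕ k - β * N) - (+ toℕ k - α * N)  ≡⟨ alg (+ toℕ k) α β N ⟩
      + 1 + (α - β) * N                            ∎))
      where open ≡-Reasoning
            alg : ∀ t a b N → (+ 1 + t - b * N) - (t - a * N) ≡ + 1 + (a - b) * N
            alg = solve-∀

    dBA≡ : dBA ≡ β - α - + 1
    dBA≡ = proj₂ (divMod-unique n′<n (begin
      f (pos A) - f (pos B)                        ≡⟨ cong₂ _-_ (fun-pos-positionOf w _) (fun-pos-positionOf w _) ⟩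
      (+ toℕ k - α * N) - (+ 1 + + toℕ k - β * N)
                                                   ≡⟨ cong (λ M → (+ toℕ k - α * M) - (+ 1 + + toℕ k - β * M)) N≡1+n′ ⟩
      (+ toℕ k - α * (+ 1 + + n′)) - (+ 1 + + toℕ k - β * (+ 1 + + n′))
                                                   ≡⟨ alg (+ toℕ k) α β (+ n′) ⟩
      + n′ + (β - α - + 1) * (+ 1 + + n′)          ≡⟨ cong (λ M → + n′ + (β - α - + 1) * M) N≡1+n′ ⟨
      + n′ + (β - α - + 1) * N                     ∎))
      where open ≡-Reasoning
            alg : ∀ t a b m → (t - a * (+ 1 + m)) - (+ 1 + t - b * (+ 1 + m)) ≡ m + (b - a - + 1) * (+ 1 + m)
            alg = solve-∀

    descent⇒divMod-< : LeftDescent w k → + B + β * N ℤ.< + A + α * N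
    descent⇒divMod-< desc =
      subst₂ ℤ._<_ (rem+quo (inv w (+ suc (toℕ k)) - + 1)) (rem+quo (inv w (+ toℕ k) - + 1))
        (ℤP.+-monoˡ-< (- + 1) desc)

    pairTerm-descent-AB : LeftDescent w k → A ℕ.< B → pairTerm f′ A B ℕ.+ 1 ≡ pairTerm f A B
    pairTerm-descent-AB desc A<B
      with i<j⇒∃[k]i+1+k≡j {β} {α}
             (divMod-<⇒quo-< {A} {B} {α} {β} A<n (ℕP.<⇒≤ A<B) (descent⇒divMod-< desc))
    ... | m , β+1+m≡α = begin
      pairTerm f′ A B ℕ.+ 1       ≡⟨ cong (ℕ._+ 1) pairTerm-s-AB ⟩
      ∣ dAB - + 1 ∣ ℕ.+ 1         ≡⟨ cong (λ d → ∣ d - + 1 ∣ ℕ.+ 1) dAB≡1+m ⟩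
      ∣ + suc m - + 1 ∣ ℕ.+ 1     ≡⟨ ℕP.+-comm m 1 ⟩
      suc m                       ≡⟨ cong ∣_∣ dAB≡1+m ⟨
      pairTerm f A B              ∎
      where open ≡-Reasoning
            alg : ∀ b m → b + m - b ≡ m
            alg = solve-∀
            dAB≡1+m : dAB ≡ + suc m
            dAB≡1+m = trans dAB≡ (trans (cong (_- β) (sym β+1+m≡α)) (alg β (+ suc m)))

    pairTerm-descent-BA : LeftDescent w k → pairTerm f′ B A ℕ.+ 1 ≡ pairTerm f B A
    pairTerm-descent-BA desc
      with i≤j⇒∃[k]i+k≡j {β} {α} (divMod-<⇒quo-≤ {A} {B} {α} {β} A<n (descent⇒divMod-< desc))
    ... | j , β+j≡α = begin
      pairTerm f′ B A ℕ.+ 1       ≡⟨ cong (ℕ._+ 1) pairTerm-s-BA ⟩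
      ∣ dBA + + 1 ∣ ℕ.+ 1         ≡⟨ cong (λ d → ∣ d + + 1 ∣ ℕ.+ 1) dBA≡-1-j ⟩
      ∣ -[1+ j ] + + 1 ∣ ℕ.+ 1    ≡⟨ ∣-[1+j]+1∣+1≡1+j j ⟩
      suc j                       ≡⟨ cong ∣_∣ dBA≡-1-j ⟨
      pairTerm f B A              ∎
      where open ≡-Reasoning
            alg : ∀ b j → b - (b + j) - + 1 ≡ - (+ 1 + j)
            alg = solve-∀
            dBA≡-1-j : dBA ≡ -[1+ j ]
            dBA≡-1-j = trans dBA≡ (trans (cong (λ a → β - a - + 1) (sym β+j≡α)) (alg β (+ j)))

    shiLength-s-descent : LeftDescent w k → shiLength f′ ℕ.+ 1 ≡ shiLength f
    shiLength-s-descent desc with ℕP.<-cmp A B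
    ... | tri< A<B _ _ = trans (pairSum-update n A<B B<n (pairTerm-s-except A<B (inj₁ (refl , refl)))
                                 (trans (pairTerm-descent-AB desc A<B) (sym (ℕP.+-identityʳ _))))
                               (ℕP.+-identityʳ _)
    ... | tri≈ _ A≡B _ = ⊥-elim (A≢B A≡B)
    ... | tri> _ _ B<A = trans (pairSum-update n B<A A<n (pairTerm-s-except B<A (inj₂ (refl , refl)))
                                 (trans (pairTerm-descent-BA desc) (sym (ℕP.+-identityʳ _))))
                               (ℕP.+-identityʳ _)

  wordWe : List (Fin n) → We n
  wordWe []       = idWe
  wordWe (k ∷ ws) = s[ k ]· wordWe ws

  fun-wordWe : ∀ ws x → fun (wordWe ws) x ≡ evalWord n ws x
  fun-wordWe []       x = refl
  fun-wordWe (k ∷ ws) x = cong (s n k) (fun-wordWe ws x)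

  shiLength-wordWe-≤ : ∀ ws → shiLength (fun (wordWe ws)) ℕ.≤ length ws
  shiLength-wordWe-≤ []       = ℕP.≤-reflexive shiLength-id
  shiLength-wordWe-≤ (k ∷ ws) = begin
    shiLength (fun (wordWe (k ∷ ws)))    ≤⟨ SwapLength.shiLength-s-≤ (wordWe ws) k ⟩
    shiLength (fun (wordWe ws)) ℕ.+ 1    ≤⟨ ℕP.+-monoˡ-≤ 1 (shiLength-wordWe-≤ ws) ⟩
    length ws ℕ.+ 1                      ≡⟨ ℕP.+-comm (length ws) 1 ⟩
    suc (length ws)                      ∎
    where open ℕP.≤-Reasoning

  shiLength-≤-word : ∀ {f} m ws → (∀ x → f x ≡ evalWord n ws x + m) → shiLength f ℕ.≤ length ws
  shiLength-≤-word {f} m ws f≗ = begin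
    shiLength f                             ≡⟨ shiLength-cong f≗ ⟩
    shiLength (λ x → evalWord n ws x + m)   ≡⟨ shiLength-+ (evalWord n ws) m ⟩
    shiLength (evalWord n ws)               ≡⟨ shiLength-cong (fun-wordWe ws) ⟨
    shiLength (fun (wordWe ws))             ≤⟨ shiLength-wordWe-≤ ws ⟩
    length ws                               ∎
    where open ℕP.≤-Reasoning

  ¬descent⇒ascent : ∀ w k → ¬ LeftDescent w k → inv w (+ toℕ k) ℤ.< inv w (+ suc (toℕ k))
  ¬descent⇒ascent w k ¬desc =
    ℤP.≤∧≢⇒< (ℤP.≮⇒≥ ¬desc) (ℕP.1+n≢n ∘ sym ∘ ℤP.+-injective ∘ inv-injective w)

  shiLength-≤-hasLength : ∀ {w ℓ} → HasLength n w ℓ → shiLength (fun w) ℕ.≤ ℓ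
  shiLength-≤-hasLength ((m , ws , refl , w≗) , _) = shiLength-≤-word m ws w≗

  -- Without left descents w⁻¹ increases at every integer; by periodicity it then increases by
  -- exactly one, so w is a translation.
  module NoDescent (w : We n) (¬desc : ∀ k → ¬ LeftDescent w k) where

    inv-<-suc : ∀ x → inv w x ℤ.< inv w (x + + 1)
    inv-<-suc x = subst₂ ℤ._<_ (sym inv-block) (sym inv-block-suc)
      (ℤP.+-monoˡ-< (quo x * N) (¬descent⇒ascent w k (¬desc k)))
      where
      k : Fin n
      k = F.fromℕ< (rem<n x)
      x≡ : x ≡ + toℕ k + quo x * N
      x≡ = trans (rem+quo x) (cong (λ r → + r + quo x * N) (sym (FP.toℕ-fromℕ< (rem<n x))))
      inv-block : inv w x ≡ inv w (+ toℕ k) + quo x * N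
      inv-block = trans (cong (inv w) x≡) (inv-+-multiple w (+ toℕ k) (quo x))
      inv-block-suc : inv w (x + + 1) ≡ inv w (+ suc (toℕ k)) + quo x * N
      inv-block-suc = trans (cong (λ y → inv w (y + + 1)) x≡)
        (trans (cong (inv w) (alg (+ toℕ k) (quo x * N))) (inv-+-multiple w (+ suc (toℕ k)) (quo x)))
        where alg : ∀ r c → r + c + + 1 ≡ + 1 + r + c
              alg = solve-∀

    inv-+-≤ : ∀ y m → inv w y + + m ℤ.≤ inv w (y + + m)
    inv-+-≤ y zero = ℤP.≤-reflexive (trans (ℤP.+-identityʳ _) (cong (inv w) (sym (ℤP.+-identityʳ y))))
    inv-+-≤ y (suc m) = begin
      inv w y + + suc m            ≡⟨ alg (inv w y) (+ m) ⟩
      inv w y + + m + + 1          ≤⟨ ℤP.+-monoˡ-≤ (+ 1) (inv-+-≤ y m) ⟩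
      inv w (y + + m) + + 1        ≡⟨ ℤP.+-comm (inv w (y + + m)) (+ 1) ⟩
      + 1 + inv w (y + + m)        ≤⟨ ℤP.i<j⇒suc[i]≤j (inv-<-suc (y + + m)) ⟩
      inv w (y + + m + + 1)        ≡⟨ cong (inv w) (alg y (+ m)) ⟨
      inv w (y + + suc m)          ∎
      where open ℤP.≤-Reasoning
            alg : ∀ y m → y + (+ 1 + m) ≡ y + m + + 1
            alg = solve-∀

    inv-suc : ∀ x → inv w (x + + 1) ≡ inv w x + + 1
    inv-suc x = ℤP.≤-antisym upper lower
      where
      lower : inv w x + + 1 ℤ.≤ inv w (x + + 1)
      lower = subst (ℤ._≤ inv w (x + + 1)) (ℤP.+-comm (+ 1) (inv w x)) (ℤP.i<j⇒suc[i]≤j (inv-<-suc x))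
      alg : ∀ x m → x + + 1 + m ≡ x + + 1 * (+ 1 + m)
      alg = solve-∀
      alg′ : ∀ a m → a + + 1 * (+ 1 + m) ≡ a + + 1 + m
      alg′ = solve-∀
      upper : inv w (x + + 1) ℤ.≤ inv w x + + 1
      upper = +-cancelʳ-≤ (+ n′) (begin
        inv w (x + + 1) + + n′         ≤⟨ inv-+-≤ (x + + 1) n′ ⟩
        inv w (x + + 1 + + n′)         ≡⟨ cong (inv w) (alg x (+ n′)) ⟩
        inv w (x + + 1 * (+ 1 + + n′)) ≡⟨ cong (λ M → inv w (x + + 1 * M)) N≡1+n′ ⟨
        inv w (x + + 1 * N)            ≡⟨ inv-+-multiple w x (+ 1) ⟩
        inv w x + + 1 * N              ≡⟨ cong (λ M → inv w x + + 1 * M) N≡1+n′ ⟩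
        inv w x + + 1 * (+ 1 + + n′)   ≡⟨ alg′ (inv w x) (+ n′) ⟩
        inv w x + + 1 + + n′           ∎)
        where open ℤP.≤-Reasoning

    inv-+ℕ : ∀ x m → inv w (x + + m) ≡ inv w x + + m
    inv-+ℕ x zero    = trans (cong (inv w) (ℤP.+-identityʳ x)) (sym (ℤP.+-identityʳ _))
    inv-+ℕ x (suc m) = begin
      inv w (x + + suc m)       ≡⟨ cong (inv w) (alg x (+ m)) ⟩
      inv w (x + + m + + 1)     ≡⟨ inv-suc (x + + m) ⟩
      inv w (x + + m) + + 1     ≡⟨ cong (_+ + 1) (inv-+ℕ x m) ⟩
      inv w x + + m + + 1       ≡⟨ alg (inv w x) (+ m) ⟨
      inv w x + + suc m         ∎
      where open ≡-Reasoning
            alg : ∀ x m → x + (+ 1 + m) ≡ x + m + + 1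
            alg = solve-∀

    inv-translation : ∀ x → inv w x ≡ x + inv w (+ 0)
    inv-translation (+ m) = trans (inv-+ℕ (+ 0) m) (ℤP.+-comm (inv w (+ 0)) (+ m))
    inv-translation x@(-[1+ m ]) = begin
      inv w x                                ≡⟨ alg (inv w x) (+ suc m) ⟩
      inv w x + + suc m - + suc m            ≡⟨ cong (_- + suc m) (inv-+ℕ x (suc m)) ⟨
      inv w (x + + suc m) - + suc m          ≡⟨ cong (λ y → inv w y - + suc m) (ℤP.+-inverseˡ (+ suc m)) ⟩
      inv w (+ 0) - + suc m                  ≡⟨ ℤP.+-comm (inv w (+ 0)) x ⟩
      x + inv w (+ 0)                        ∎
      where open ≡-Reasoning
            alg : ∀ a m → a ≡ a + m - m
            alg = solve-∀

    fun-translation : ∀ x → fun w x ≡ x - inv w (+ 0)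
    fun-translation x = begin
      fun w x                             ≡⟨ cong (fun w) (alg x (inv w (+ 0))) ⟩
      fun w (x - inv w (+ 0) + inv w (+ 0)) ≡⟨ cong (fun w) (inv-translation (x - inv w (+ 0))) ⟨
      fun w (inv w (x - inv w (+ 0)))      ≡⟨ fun-inv w _ ⟩
      x - inv w (+ 0)                      ∎
      where open ≡-Reasoning
            alg : ∀ x c → x ≡ x - c + c
            alg = solve-∀

  reducedWord : ∀ M (w : We n) → shiLength (fun w) ≡ M →
    Σ ℤ λ m → Σ (List (Fin n)) λ ws → length ws ≡ M × (∀ x → fun w x ≡ evalWord n ws x + m)
  reducedWord M w len with FP.any? (leftDescent? w)
  reducedWord zero w len | yes (k , desc) =
    ⊥-elim (ℕP.m+1+n≢0 (shiLength (fun (s[ k ]· w))) (trans (SwapLength.shiLength-s-descent w k desc) len))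
  reducedWord (suc M) w len | yes (k , desc)
    with reducedWord M (s[ k ]· w)
           (ℕP.suc-injective (trans (ℕP.+-comm 1 _) (trans (SwapLength.shiLength-s-descent w k desc) len)))
  ... | m , ws , len′ , s·w≗ = m , shiftIndex k m ∷ ws , cong suc len′ , λ x → begin
    fun w x                                  ≡⟨ s-involutive k (fun w x) ⟨
    s n k (fun (s[ k ]· w) x)                ≡⟨ cong (s n k) (s·w≗ x) ⟩
    s n k (evalWord n ws x + m)              ≡⟨ s-shift k m (evalWord n ws x) ⟩
    s n (shiftIndex k m) (evalWord n ws x) + m ∎
    where open ≡-Reasoning
  reducedWord M w len | no ¬desc = - inv w (+ 0) , [] , sym (trans (sym len) length≡0) , fun-translation
    where
    open NoDescent w (λ k → ¬desc ∘ (k ,_))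
    length≡0 : shiLength (fun w) ≡ 0
    length≡0 = trans (shiLength-cong fun-translation) (shiLength-translation (- inv w (+ 0)))

  hasLength-shiLength : ∀ (w : We n) → HasLength n w (shiLength (fun w))
  hasLength-shiLength w = reducedWord _ w refl , shiLength-≤-word

  module MinimalInCoset (z : We n) (ℓz : ℕ) (minimal : MinInCoset n z ℓz) (hasLength : HasLength n z ℓz)
    where

    no-descent : ∀ k → toℕ k ≢ 0 → ¬ LeftDescent z k
    no-descent k k≢0 desc = ℕP.<-irrefl refl (begin-strict
      ℓz                                   ≤⟨ minimal (s[ k ]· idWe) (s[ k ]· z) _
                                                (k ∷ [] , k≢0 ∷ [] , λ _ → refl) (λ _ → refl)
                                                (hasLength-shiLength (s[ k ]· z)) ⟩
      shiLength (fun (s[ k ]· z))          <⟨ ℕP.m<m+n _ ℕP.0<1+n ⟩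
      shiLength (fun (s[ k ]· z)) ℕ.+ 1    ≡⟨ SwapLength.shiLength-s-descent z k desc ⟩
      shiLength (fun z)                    ≤⟨ shiLength-≤-hasLength {z} hasLength ⟩
      ℓz                                   ∎)
      where open ℕP.≤-Reasoning

    inv-pos-<-suc : ∀ {a} → suc a ℕ.< n → inv z (pos a) ℤ.< inv z (pos (suc a))
    inv-pos-<-suc a+1<n = subst₂ (λ i j → inv z (+ i) ℤ.< inv z (+ suc j)) toℕk≡ toℕk≡
      (¬descent⇒ascent z k (no-descent k (ℕP.1+n≢0 ∘ trans (sym toℕk≡))))
      where k : Fin n
            k = F.fromℕ< a+1<n
            toℕk≡ : toℕ k ≡ suc _
            toℕk≡ = FP.toℕ-fromℕ< a+1<n

    inv-pos-< : ∀ {a b} → a ℕ.< b → b ℕ.< n → inv z (pos a) ℤ.< inv z (pos b)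
    inv-pos-< {a} {suc b} (s≤s a≤b) b+1<n with ℕP.m≤n⇒m<n∨m≡n a≤b
    ... | inj₁ a<b  = ℤP.<-trans (inv-pos-< a<b (ℕP.<-trans (ℕP.n<1+n b) b+1<n)) (inv-pos-<-suc b+1<n)
    ... | inj₂ refl = inv-pos-<-suc b+1<n

  -- block x = k exactly when x ∈ {kn+1,…,kn+n}; s_1,…,s_{n−1} never move an integer across
  -- a block boundary.
  block : ℤ → ℤ
  block x = quo (x - + 1)

  block-s : ∀ k → toℕ k ≢ 0 → ∀ x → block (s n k x) ≡ block x
  block-s k k≢0 x with rem x ℕ.≟ toℕ k | rem x ℕ.≟ succMod k
  ... | yes ≡k | _ = begin
    quo (s n k x - + 1)       ≡⟨ cong (λ y → quo (y - + 1)) (s-up k x ≡k) ⟩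
    quo (x + + 1 - + 1)       ≡⟨ cong quo (alg x) ⟩
    quo (x - + 1 + + 1)       ≡⟨ quo-suc (x - + 1) (λ eq → k≢0 (trans (sym ≡k) (rem-pred≡n′ eq))) ⟩
    quo (x - + 1)             ∎
    where
    open ≡-Reasoning
    alg : ∀ x → x + + 1 - + 1 ≡ x - + 1 + + 1
    alg = solve-∀
    alg′ : ∀ x → x ≡ x - + 1 + + 1
    alg′ = solve-∀
    rem-pred≡n′ : rem (x - + 1) ≡ n′ → rem x ≡ 0
    rem-pred≡n′ eq = begin
      rem x                  ≡⟨ cong rem (alg′ x) ⟩
      rem (x - + 1 + + 1)    ≡⟨ rem-+ (x - + 1) (+ n′) (+ 1) (trans eq (sym (rem-small n′<n))) ⟩
      rem (+ (n′ ℕ.+ 1))     ≡⟨ cong (rem ∘ +_) (trans (ℕP.+-comm n′ 1) (ℕP.suc-pred n)) ⟩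
      n ℕ.% n                ≡⟨ ℕD.n%n≡0 n ⟩
      0                      ∎
  ... | no _ | yes ≡k+1 = begin
    quo (s n k x - + 1)       ≡⟨ cong (λ y → quo (y - + 1)) (s-down k x ≡k+1) ⟩
    quo (x - + 1 - + 1)       ≡⟨ quo-pred (x - + 1) (k≢0 ∘ trans (sym (rem-pred k x ≡k+1))) ⟩
    quo (x - + 1)             ∎
    where open ≡-Reasoning
  ... | no ≢k | no ≢k+1 = cong block (s-fix k x ≢k ≢k+1)

  block-evalWord : ∀ {ws} → All (λ i → toℕ i ≢ 0) ws → ∀ x → block (evalWord n ws x) ≡ block x
  block-evalWord {[]}     []           x = refl
  block-evalWord {k ∷ ws} (k≢0 ∷ ws≢0) x = trans (block-s k k≢0 (evalWord n ws x)) (block-evalWord ws≢0 x)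

  block-inv : ∀ u → InWf n u → ∀ t → block (inv u t) ≡ block t
  block-inv u (ws , ws≢0 , u≗) t = begin
    block (inv u t)                     ≡⟨ block-evalWord ws≢0 (inv u t) ⟨
    block (evalWord n ws (inv u t))     ≡⟨ cong block (u≗ (inv u t)) ⟨
    block (fun u (inv u t))             ≡⟨ cong block (fun-inv u t) ⟩
    block t                             ∎
    where open ≡-Reasoning

  block-pos : ∀ {a} → a ℕ.< n → block (pos a) ≡ + 0
  block-pos {a} a<n = proj₂ (divMod-unique a<n (alg (+ a) N))
    where alg : ∀ a N → + 1 + a - + 1 ≡ a + + 0 * N
          alg = solve-∀

  block≡0⇒pos-index : ∀ x → block x ≡ + 0 → x ≡ pos (index x)
  block≡0⇒pos-index x block≡0 = sym (begin
    pos (index x)             ≡⟨ pos-index x ⟩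
    x - block x * N           ≡⟨ cong (λ q → x - q * N) block≡0 ⟩
    x - + 0 * N               ≡⟨ alg x N ⟩
    x                         ∎)
    where open ≡-Reasoning
          alg : ∀ x N → x - + 0 * N ≡ x
          alg = solve-∀

  module Parabolic (u : We n) (u∈Wf : InWf n u) where

    perm : Fin n → ℕ
    perm j = index (inv u (pos (toℕ j)))

    perm<n : ∀ j → perm j ℕ.< n
    perm<n j = index<n (inv u (pos (toℕ j)))

    inv-pos : ∀ j → inv u (pos (toℕ j)) ≡ pos (perm j)
    inv-pos j = block≡0⇒pos-index _ (trans (block-inv u u∈Wf _) (block-pos (FP.toℕ<n j)))

    perm-injective : Injective _≡_ _≡_ perm
    perm-injective {i} {j} eq = FP.toℕ-injective (ℕP.suc-injective (ℤP.+-injective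
      (inv-injective u (trans (inv-pos i) (trans (cong pos eq) (sym (inv-pos j)))))))

    perm-onto : ∀ {c} → c ℕ.< n → Σ (Fin n) λ j → perm j ≡ c
    perm-onto {c} c<n = j , (begin
      index (inv u (pos (toℕ j)))      ≡⟨ cong (λ a → index (inv u (pos a))) (FP.toℕ-fromℕ< (index<n t)) ⟩
      index (inv u (pos (index t)))    ≡⟨ cong (index ∘ inv u) t≡ ⟨
      index (inv u t)                  ≡⟨ cong index (inv-fun u (pos c)) ⟩
      index (pos c)                    ≡⟨ index-pos c<n ⟩
      c                                ∎)
      where
      open ≡-Reasoning
      t : ℤ
      t = fun u (pos c)
      t≡ : t ≡ pos (index t)
      t≡ = block≡0⇒pos-index t
             (trans (sym (block-inv u u∈Wf t)) (trans (cong block (inv-fun u (pos c))) (block-pos c<n)))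
      j : Fin n
      j = F.fromℕ< (index<n t)

    window-perm : ∀ j → window n u j ≡ + (n ∸ perm j)
    window-perm j = trans (cong (λ t → + suc n - t) (inv-pos j)) (ℤP.⊖-≥ (s≤s (ℕP.<⇒≤ (perm<n j))))

  window-standardize : ∀ (w u z : We n) ℓz → InWf n u → (∀ x → fun w x ≡ fun u (fun z x)) →
    MinInCoset n z ℓz → HasLength n z ℓz → ∀ j → window n u j ≡ + standardize n (window n w) j
  window-standardize w u z ℓz u∈Wf w≗uz minimal hasLength j = begin
    window n u j                     ≡⟨ window-perm j ⟩
    + (n ∸ perm j)                   ≡⟨ cong +_ (standardize-antitone perm perm<n perm-injective perm-onto
                                                  (window n w) antitone j) ⟨
    + standardize n (window n w) j   ∎
    where
    open ≡-Reasoning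
    open Parabolic u u∈Wf
    open MinimalInCoset z ℓz minimal hasLength
    inv-w : ∀ x → inv w x ≡ inv z (inv u x)
    inv-w x = fun-injective w (trans (fun-inv w x)
      (sym (trans (w≗uz _) (trans (cong (fun u) (fun-inv z _)) (fun-inv u x)))))
    window-w : ∀ k → window n w k ≡ + suc n - inv z (pos (perm k))
    window-w k = cong (λ t → + suc n - t) (trans (inv-w _) (cong (inv z) (inv-pos k)))
    antitone : ∀ {a b} → perm a ℕ.< perm b → window n w b ℤ.< window n w a
    antitone {a} {b} lt = subst₂ ℤ._<_ (sym (window-w b)) (sym (window-w a))
      (ℤP.+-monoʳ-< (+ suc n) (ℤP.neg-mono-< (inv-pos-< lt (perm<n b))))

mainTheorem17 : (n : ℕ) .{{_ : NonZero n}} → 2 ℕ.≤ n →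
    (w u z : We n) (ℓu ℓz : ℕ) →
    InWf n u →
    (∀ x → fun w x ≡ fun u (fun z x)) →
    MinInCoset n z ℓz →
    HasLength n u ℓu → HasLength n z ℓz → HasLength n w (ℓu ℕ.+ ℓz) →
    ∀ (j : Fin n) → window n u j ≡ + standardize n (window n w) j
mainTheorem17 n 2≤n w u z ℓu ℓz u∈Wf w≗uz minimal _ hasLength-z _ =
  AffinePermutations.window-standardize n 2≤n w u z ℓz u∈Wf w≗uz minimal hasLength-z
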